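{- Let $m$ be a positive integer and let $B,Y,Z$ be sets with $B\cap Y=\emptyset$, $B\cap Z=\emptyset$ and $|B|+|Y|+|Z|=4m$. Then there exists a list assignment $L$ on the path $P_3=v_1v_2v_3$ such that $|L(v)|=4m$ for all $v\in V(P_3)$, $(A,\hat X_1,\hat X_3)=(B,Y,Z)$, and $S_L(P_3)=8m$.
   Context: For a list assignment $L$ on a path $v_1\cdots v_n$: $X_1=L(v_1)$, $X_i=L(v_i)\setminus X_{i-1}$ ($i>1$), $S_L=\sum_i|X_i|$; $A=\bigcap_i L(v_i)$; for $c\in L(v_1)\setminus A$, $f(c)=\min\{i: c\notin L(v_i)\}$; $\hat X_1=\{c\in L(v_1)\setminus A : f(c)\text{ even}\}$; $\hat X_n=X_n\setminus A$. -}

module Defs where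

open import Data.Nat using (ℕ; zero; suc; _+_)
open import Data.Nat.Base using (_%_)
open import Data.List using (List; []; _∷_; filter; length; map; last)
open import Data.Nat.ListAction using (sum)
open import Data.List.Membership.Propositional using (_∈_)
open import Data.List.Membership.DecPropositional (Data.Nat._≟_) using (_∈?_; _∉?_)
open import Data.List.Relation.Unary.All using (All)
open import Data.List.Relation.Unary.All using (all?)
open import Data.Maybe using (Maybe; just; nothing)
open import Data.Product using (_×_)
open import Relation.Nullary using (¬_; ¬?)
open import Relation.Nullary.Decidable using (_×-dec_)

-- A "list" L(v) (a finite set of colours) is a
-- List ℕ (duplicate-freeness is imposed separately via Unique where needed).
-- A list assignment on the path v₁⋯vₙ is the List of lists [L(v₁), …, L(vₙ)].

Colour : Set
Colour = ℕ

_∖_ : List Colour → List Colour → List Colour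
xs ∖ ys = filter (λ c → c ∉? ys) xs

Xs-from : List Colour → List (List Colour) → List (List Colour)
Xs-from prev []       = []
Xs-from prev (L ∷ Ls) = let x = L ∖ prev in x ∷ Xs-from x Ls

Xs : List (List Colour) → List (List Colour)
Xs []       = []
Xs (L ∷ Ls) = L ∷ Xs-from L Ls

S : List (List Colour) → ℕ
S Ls = sum (map length (Xs Ls))

A : List (List Colour) → List Colour
A []       = []
A (L ∷ Ls) = filter (λ c → all? (λ M → c ∈? M) (L ∷ Ls)) L

-- f(c) = min { i : c ∉ L(vᵢ) }  (1-based); returns n+1 if c lies in every list
-- (never used for such c).
f-from : ℕ → Colour → List (List Colour) → ℕ
f-from i c []       = i
f-from i c (L ∷ Ls) with c ∈? L
... | Relation.Nullary.yes _ = f-from (suc i) c Ls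
... | Relation.Nullary.no  _ = i

f : List (List Colour) → Colour → ℕ
f Ls c = f-from 1 c Ls

X̂₁ : List (List Colour) → List Colour
X̂₁ []         = []
X̂₁ (L ∷ Ls)   =
  filter (λ c → (c ∉? A (L ∷ Ls)) ×-dec (f (L ∷ Ls) c % 2 Data.Nat.≟ 0)) L

X̂ₙ : List (List Colour) → List Colour
X̂ₙ Ls with last (Xs Ls)
... | just Xn = Xn ∖ A Ls
... | nothing = []

_≐_ : List Colour → List Colour → Set
xs ≐ ys = ∀ c → ((c ∈ xs → c ∈ ys) × (c ∈ ys → c ∈ xs))

-- Keep B as the common colours of all three lists and use fresh colours W
-- (a copy of Z) and U (a copy of Y), lying above every colour of B, Y, Z:
--   L₁ = B ∪ Y ∪ W,   L₂ = B ∪ W ∪ U,   L₃ = B ∪ Z ∪ U.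
-- Then X₁ = L₁, X₂ = U and X₃ = B ∪ Z, so S_L = (|B|+|Y|+|Z|) + (|Y|+|B|+|Z|) = 8m.
-- A colour of Y leaves the path at v₂ (f = 2), one of W at v₃ (f = 3), so X̂₁ = Y,
-- and X̂₃ = X₃ ∖ B = Z.
module Submission where

open import Defs
open import Data.Nat using (ℕ; suc; _+_; _*_; _≤_; _<_; _%_; s≤s; _≟_)
open import Data.Nat.Properties
  using (m≤m+n; m≤n+m; +-identityʳ; 0≢1+n; ≤-trans; m+n≮m; +-cancelˡ-≡; +-assoc; *-distribʳ-+; +-commutativeSemigroup)
open import Algebra.Properties.CommutativeSemigroup +-commutativeSemigroup using (xy∙z≈xz∙y; x∙yz≈yx∙z)
open import Data.Nat.ListAction using (sum)
open import Data.List using (List; []; _∷_; _++_; length; map; filter)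
open import Data.List.Properties using (filter-all; filter-none; filter-++; length-map; length-++; ++-identityʳ)
open import Data.List.Membership.Propositional using (_∈_; _∉_)
open import Data.List.Membership.Propositional.Properties using (∈-map⁻; ∈-++⁻)
open import Data.List.Membership.DecPropositional _≟_ using (_∈?_; _∉?_)
open import Data.List.Relation.Unary.Any using (here; there)
open import Data.List.Relation.Unary.All as All using (All; []; _∷_)
import Data.List.Relation.Unary.All.Properties as All
open import Data.List.Relation.Unary.Unique.Propositional using (Unique)
import Data.List.Relation.Unary.Unique.Propositional.Properties as Unique
open import Data.List.Relation.Binary.Disjoint.Propositional using (Disjoint)
import Data.List.Relation.Binary.Disjoint.Propositional.Properties as Disjoint
open import Data.List.Relation.Binary.Subset.Propositional using (_⊆_)
open import Data.List.Relation.Binary.Subset.Propositional.Properties using (⊆-refl; xs⊆xs++ys; xs⊆ys++xs)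
import Data.List.Relation.Binary.Subset.Propositional.Properties as Subset
open import Data.Product using (_×_; _,_; ∃-syntax)
open import Data.Sum using (inj₁; inj₂)
open import Data.Empty using (⊥-elim)
open import Function using (_∘_)
open import Level using (Level)
open import Relation.Nullary using (¬_; yes; no)
open import Relation.Nullary.Decidable using (_×-dec_)
open import Relation.Unary using (Pred; Decidable)
open import Relation.Binary.PropositionalEquality using (_≡_; refl; sym; trans; cong; cong₂; subst; module ≡-Reasoning)
open ≡-Reasoning

private
  variable
    a p : Level
    X : Set a
    xs ys zs : List X

∈⇒≤sum : ∀ {n ns} → n ∈ ns → n ≤ sum ns
∈⇒≤sum {ns = n ∷ ns} (here refl) = m≤m+n n (sum ns)
∈⇒≤sum {ns = m ∷ ns} (there n∈ns) = ≤-trans (∈⇒≤sum n∈ns) (m≤n+m (sum ns) m)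

all<suc-sum : (ns : List ℕ) → All (_< suc (sum ns)) ns
all<suc-sum ns = All.tabulate (s≤s ∘ ∈⇒≤sum)

Disjoint-++ˡ : Disjoint xs zs → Disjoint ys zs → Disjoint (xs ++ ys) zs
Disjoint-++ˡ {xs = xs} xs#zs ys#zs (v∈xs++ys , v∈zs) with ∈-++⁻ xs v∈xs++ys
... | inj₁ v∈xs = xs#zs (v∈xs , v∈zs)
... | inj₂ v∈ys = ys#zs (v∈ys , v∈zs)

Disjoint-++ʳ : Disjoint xs ys → Disjoint xs zs → Disjoint xs (ys ++ zs)
Disjoint-++ʳ xs#ys xs#zs =
  Disjoint.sym (Disjoint-++ˡ (Disjoint.sym xs#ys) (Disjoint.sym xs#zs))

all<⇒Disjoint-shift : ∀ {n ms} ns → All (_< n) ms → Disjoint ms (map (n +_) ns)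
all<⇒Disjoint-shift {n} ns ms<n (m∈ms , m∈shift) with ∈-map⁻ (n +_) m∈shift
... | k , _ , refl = m+n≮m n k (All.lookup ms<n m∈ms)

shift⁺-Disjoint : ∀ {n ms ns} → Disjoint ms ns → Disjoint (map (n +_) ms) (map (n +_) ns)
shift⁺-Disjoint {n} ms#ns (v∈ms′ , v∈ns′) with ∈-map⁻ (n +_) v∈ms′ | ∈-map⁻ (n +_) v∈ns′
... | i , i∈ms , refl | j , j∈ns , n+i≡n+j =
  ms#ns (i∈ms , subst (_∈ _) (sym (+-cancelˡ-≡ n i j n+i≡n+j)) j∈ns)

filter-++-all-none : {P : Pred X p} (P? : Decidable P) →
                     All P xs → All (¬_ ∘ P) ys → filter P? (xs ++ ys) ≡ xs
filter-++-all-none {xs = xs} {ys = ys} P? all none = begin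
  filter P? (xs ++ ys)          ≡⟨ filter-++ P? xs ys ⟩
  filter P? xs ++ filter P? ys  ≡⟨ cong₂ _++_ (filter-all P? all) (filter-none P? none) ⟩
  xs ++ []                      ≡⟨ ++-identityʳ xs ⟩
  xs                            ∎

filter-++-none-all : {P : Pred X p} (P? : Decidable P) →
                     All (¬_ ∘ P) xs → All P ys → filter P? (xs ++ ys) ≡ ys
filter-++-none-all {xs = xs} {ys = ys} P? none all = begin
  filter P? (xs ++ ys)          ≡⟨ filter-++ P? xs ys ⟩
  filter P? xs ++ filter P? ys  ≡⟨ cong₂ _++_ (filter-none P? none) (filter-all P? all) ⟩
  ys                            ∎

Disjoint⇒all∉ : Disjoint xs zs → All (_∉ zs) xs
Disjoint⇒all∉ xs#zs = All.tabulate λ v∈xs v∈zs → xs#zs (v∈xs , v∈zs)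

⊆⇒all¬∉ : xs ⊆ zs → All (¬_ ∘ (_∉ zs)) xs
⊆⇒all¬∉ xs⊆zs = All.tabulate λ v∈xs v∉zs → v∉zs (xs⊆zs v∈xs)

[xs++ys]∖zs≡xs : ∀ {xs ys zs} → Disjoint xs zs → ys ⊆ zs → (xs ++ ys) ∖ zs ≡ xs
[xs++ys]∖zs≡xs {zs = zs} xs#zs ys⊆zs =
  filter-++-all-none (_∉? zs) (Disjoint⇒all∉ xs#zs) (⊆⇒all¬∉ ys⊆zs)

[xs++ys]∖zs≡ys : ∀ {xs ys zs} → xs ⊆ zs → Disjoint ys zs → (xs ++ ys) ∖ zs ≡ ys
[xs++ys]∖zs≡ys {zs = zs} xs⊆zs ys#zs =
  filter-++-none-all (_∉? zs) (⊆⇒all¬∉ xs⊆zs) (Disjoint⇒all∉ ys#zs)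

f-from-∈ : ∀ {i c L} Ls → c ∈ L → f-from i c (L ∷ Ls) ≡ f-from (suc i) c Ls
f-from-∈ {c = c} {L} Ls c∈L with c ∈? L
... | yes _   = refl
... | no c∉L = ⊥-elim (c∉L c∈L)

f-from-∉ : ∀ {i c L} Ls → c ∉ L → f-from i c (L ∷ Ls) ≡ i
f-from-∉ {c = c} {L} Ls c∉L with c ∈? L
... | yes c∈L = ⊥-elim (c∉L c∈L)
... | no _    = refl

f≡2 : ∀ {c L₁ L₂} Ls → c ∈ L₁ → c ∉ L₂ → f (L₁ ∷ L₂ ∷ Ls) c ≡ 2
f≡2 {L₂ = L₂} Ls c∈L₁ c∉L₂ = trans (f-from-∈ (L₂ ∷ Ls) c∈L₁) (f-from-∉ Ls c∉L₂)

f≡3 : ∀ {c L₁ L₂ L₃} Ls → c ∈ L₁ → c ∈ L₂ → c ∉ L₃ → f (L₁ ∷ L₂ ∷ L₃ ∷ Ls) c ≡ 3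
f≡3 {L₂ = L₂} {L₃} Ls c∈L₁ c∈L₂ c∉L₃ =
  trans (f-from-∈ (L₂ ∷ L₃ ∷ Ls) c∈L₁) (trans (f-from-∈ (L₃ ∷ Ls) c∈L₂) (f-from-∉ Ls c∉L₃))

S-path₃ : ∀ L₁ L₂ L₃ →
          S (L₁ ∷ L₂ ∷ L₃ ∷ []) ≡ length L₁ + (length (L₂ ∖ L₁) + length (L₃ ∖ (L₂ ∖ L₁)))
S-path₃ L₁ L₂ L₃ =
  cong (λ n → length L₁ + (length (L₂ ∖ L₁) + n)) (+-identityʳ (length (L₃ ∖ (L₂ ∖ L₁))))

≡⇒≐ : ∀ {xs ys} → xs ≡ ys → xs ≐ ys
≡⇒≐ refl c = (λ c∈ → c∈) , (λ c∈ → c∈)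

module Path₃Construction (B Y Z : List Colour) (B#Y : Disjoint B Y) (B#Z : Disjoint B Z) where

  N : ℕ
  N = suc (sum (B ++ Y ++ Z))

  W U : List Colour
  W = map (N +_) Z
  U = map (N +_) (map (N +_) Y)

  L₁ L₂ L₃ : List Colour
  L₁ = B ++ (Y ++ W)
  L₂ = (B ++ W) ++ U
  L₃ = (B ++ Z) ++ U

  Ls : List (List Colour)
  Ls = L₁ ∷ L₂ ∷ L₃ ∷ []

  private
    B<N : All (_< N) B
    B<N = All.++⁻ˡ B (all<suc-sum (B ++ Y ++ Z))

    Y<N : All (_< N) Y
    Y<N = All.++⁻ˡ Y (All.++⁻ʳ B (all<suc-sum (B ++ Y ++ Z)))

    Z<N : All (_< N) Z
    Z<N = All.++⁻ʳ Y (All.++⁻ʳ B (all<suc-sum (B ++ Y ++ Z)))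

    B#W : Disjoint B W
    B#W = all<⇒Disjoint-shift Z B<N

    Y#W : Disjoint Y W
    Y#W = all<⇒Disjoint-shift Z Y<N

    B#U : Disjoint B U
    B#U = all<⇒Disjoint-shift (map (N +_) Y) B<N

    Y#U : Disjoint Y U
    Y#U = all<⇒Disjoint-shift (map (N +_) Y) Y<N

    Z#U : Disjoint Z U
    Z#U = all<⇒Disjoint-shift (map (N +_) Y) Z<N

    Z#W : Disjoint Z W
    Z#W = all<⇒Disjoint-shift Z Z<N

    W#U : Disjoint W U
    W#U = shift⁺-Disjoint (all<⇒Disjoint-shift Y Z<N)

    Y#L₂ : Disjoint Y L₂
    Y#L₂ = Disjoint-++ʳ (Disjoint-++ʳ (Disjoint.sym B#Y) Y#W) Y#U

    W#L₃ : Disjoint W L₃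
    W#L₃ = Disjoint-++ʳ (Disjoint-++ʳ (Disjoint.sym B#W) (Disjoint.sym Z#W)) W#U

    B++W⊆L₁ : B ++ W ⊆ L₁
    B++W⊆L₁ = Subset.++⁺ʳ B (xs⊆ys++xs W Y)

    B++W⊆L₂ : B ++ W ⊆ L₂
    B++W⊆L₂ = xs⊆xs++ys (B ++ W) U

    B⊆L₃ : B ⊆ L₃
    B⊆L₃ = xs⊆xs++ys (B ++ Z) U ∘ xs⊆xs++ys B Z

  X₂≡U : L₂ ∖ L₁ ≡ U
  X₂≡U = [xs++ys]∖zs≡ys B++W⊆L₁ (Disjoint.sym (Disjoint-++ˡ B#U (Disjoint-++ˡ Y#U W#U)))

  X₃≡B++Z : L₃ ∖ U ≡ B ++ Z
  X₃≡B++Z = [xs++ys]∖zs≡xs (Disjoint-++ˡ B#U Z#U) ⊆-refl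

  A≡B : A Ls ≡ B
  A≡B = filter-++-all-none (λ c → All.all? (c ∈?_) Ls)
    (All.tabulate λ b∈B → let b∈B++W = xs⊆xs++ys B W b∈B in
                          B++W⊆L₁ b∈B++W ∷ B++W⊆L₂ b∈B++W ∷ B⊆L₃ b∈B ∷ [])
    (All.++⁺ (All.tabulate λ { y∈Y (_ ∷ y∈L₂ ∷ _) → Y#L₂ (y∈Y , y∈L₂) })
             (All.tabulate λ { w∈W (_ ∷ _ ∷ w∈L₃ ∷ _) → W#L₃ (w∈W , w∈L₃) }))

  X̂₁≡Y : X̂₁ Ls ≡ Y
  X̂₁≡Y = begin
    filter Q? (B ++ (Y ++ W))            ≡⟨ filter-++ Q? B (Y ++ W) ⟩
    filter Q? B ++ filter Q? (Y ++ W)    ≡⟨ cong (_++ filter Q? (Y ++ W)) (filter-none Q? B-rejected) ⟩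
    filter Q? (Y ++ W)                   ≡⟨ filter-++-all-none Q? Y-accepted W-rejected ⟩
    Y                                    ∎
    where
    Q? : Decidable (λ c → c ∉ A Ls × f Ls c % 2 ≡ 0)
    Q? = λ c → (c ∉? A Ls) ×-dec (f Ls c % 2 ≟ 0)
    B-rejected : All (λ c → ¬ (c ∉ A Ls × f Ls c % 2 ≡ 0)) B
    B-rejected = All.tabulate λ b∈B (b∉A , _) → b∉A (subst (_ ∈_) (sym A≡B) b∈B)
    Y-accepted : All (λ c → c ∉ A Ls × f Ls c % 2 ≡ 0) Y
    Y-accepted = All.tabulate λ y∈Y →
      (λ y∈A → B#Y (subst (_ ∈_) A≡B y∈A , y∈Y)) ,
      cong (_% 2) (f≡2 (L₃ ∷ []) (xs⊆ys++xs (Y ++ W) B (xs⊆xs++ys Y W y∈Y)) λ y∈L₂ → Y#L₂ (y∈Y , y∈L₂))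
    W-rejected : All (λ c → ¬ (c ∉ A Ls × f Ls c % 2 ≡ 0)) W
    W-rejected = All.tabulate λ w∈W (_ , f%2≡0) →
      let w∈B++W = xs⊆ys++xs W B w∈W in
      0≢1+n (trans (sym f%2≡0) (cong (_% 2) (f≡3 [] (B++W⊆L₁ w∈B++W) (B++W⊆L₂ w∈B++W)
                                                   (λ w∈L₃ → W#L₃ (w∈W , w∈L₃)))))

  X̂ₙ≡Z : X̂ₙ Ls ≡ Z
  X̂ₙ≡Z = begin
    (L₃ ∖ (L₂ ∖ L₁)) ∖ A Ls  ≡⟨ cong₂ _∖_ (trans (cong (L₃ ∖_) X₂≡U) X₃≡B++Z) A≡B ⟩
    (B ++ Z) ∖ B             ≡⟨ [xs++ys]∖zs≡ys ⊆-refl (Disjoint.sym B#Z) ⟩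
    Z                        ∎

  module _ (B! : Unique B) (Y! : Unique Y) (Z! : Unique Z) where

    private
      shift-injective : ∀ {i j} → N + i ≡ N + j → i ≡ j
      shift-injective {i} {j} = +-cancelˡ-≡ N i j

      W! : Unique W
      W! = Unique.map⁺ shift-injective Z!

      U! : Unique U
      U! = Unique.map⁺ shift-injective (Unique.map⁺ shift-injective Y!)

    L₁! : Unique L₁
    L₁! = Unique.++⁺ B! (Unique.++⁺ Y! W! Y#W) (Disjoint-++ʳ B#Y B#W)

    L₂! : Unique L₂
    L₂! = Unique.++⁺ (Unique.++⁺ B! W! B#W) U! (Disjoint-++ˡ B#U W#U)

    L₃! : Unique L₃
    L₃! = Unique.++⁺ (Unique.++⁺ B! Z! B#Z) U! (Disjoint-++ˡ B#U Z#U)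

  private
    b y z : ℕ
    b = length B
    y = length Y
    z = length Z

    length-U : length U ≡ y
    length-U = trans (length-map (N +_) (map (N +_) Y)) (length-map (N +_) Y)

    length-B++Z : length (B ++ Z) ≡ b + z
    length-B++Z = length-++ B

  length-L₁ : length L₁ ≡ b + y + z
  length-L₁ = begin
    length (B ++ (Y ++ W))        ≡⟨ length-++ B ⟩
    b + length (Y ++ W)           ≡⟨ cong (b +_) (length-++ Y) ⟩
    b + (y + length W)            ≡⟨ cong (λ n → b + (y + n)) (length-map (N +_) Z) ⟩
    b + (y + z)                   ≡⟨ sym (+-assoc b y z) ⟩
    b + y + z                     ∎

  length-L₂ : length L₂ ≡ b + y + z
  length-L₂ = begin
    length ((B ++ W) ++ U)        ≡⟨ length-++ (B ++ W) ⟩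
    length (B ++ W) + length U    ≡⟨ cong₂ _+_ (trans (length-++ B) (cong (b +_) (length-map (N +_) Z))) length-U ⟩
    b + z + y                     ≡⟨ xy∙z≈xz∙y b z y ⟩
    b + y + z                     ∎

  length-L₃ : length L₃ ≡ b + y + z
  length-L₃ = begin
    length ((B ++ Z) ++ U)        ≡⟨ length-++ (B ++ Z) ⟩
    length (B ++ Z) + length U    ≡⟨ cong₂ _+_ length-B++Z length-U ⟩
    b + z + y                     ≡⟨ xy∙z≈xz∙y b z y ⟩
    b + y + z                     ∎

  S≡ : S Ls ≡ (b + y + z) + (b + y + z)
  S≡ = begin
    S Ls                                            ≡⟨ S-path₃ L₁ L₂ L₃ ⟩
    length L₁ + (length (L₂ ∖ L₁) + length (L₃ ∖ (L₂ ∖ L₁)))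
      ≡⟨ cong (λ L → length L₁ + (length L + length (L₃ ∖ L))) X₂≡U ⟩
    length L₁ + (length U + length (L₃ ∖ U))        ≡⟨ cong (λ L → length L₁ + (length U + length L)) X₃≡B++Z ⟩
    length L₁ + (length U + length (B ++ Z))        ≡⟨ cong₂ _+_ length-L₁ (cong₂ _+_ length-U length-B++Z) ⟩
    (b + y + z) + (y + (b + z))                     ≡⟨ cong ((b + y + z) +_) (x∙yz≈yx∙z y b z) ⟩
    (b + y + z) + (b + y + z)                       ∎

lemma7p3 : (m : ℕ) → 1 ≤ m →
    (B Y Z : List Colour) → Unique B → Unique Y → Unique Z →
    Disjoint B Y → Disjoint B Z →
    length B + length Y + length Z ≡ 4 * m →
    ∃[ L₁ ] ∃[ L₂ ] ∃[ L₃ ]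
      ((Unique L₁ × Unique L₂ × Unique L₃) ×
       (length L₁ ≡ 4 * m × length L₂ ≡ 4 * m × length L₃ ≡ 4 * m) ×
       (A (L₁ ∷ L₂ ∷ L₃ ∷ []) ≐ B ×
        X̂₁ (L₁ ∷ L₂ ∷ L₃ ∷ []) ≐ Y ×
        X̂ₙ (L₁ ∷ L₂ ∷ L₃ ∷ []) ≐ Z) ×
       S (L₁ ∷ L₂ ∷ L₃ ∷ []) ≡ 8 * m)
-- The construction does not need 1 ≤ m.
lemma7p3 m _ B Y Z B! Y! Z! B#Y B#Z |BYZ|≡4m =
  L₁ , L₂ , L₃ ,
  (L₁! B! Y! Z! , L₂! B! Y! Z! , L₃! B! Y! Z!) ,
  (trans length-L₁ |BYZ|≡4m , trans length-L₂ |BYZ|≡4m , trans length-L₃ |BYZ|≡4m) ,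
  (≡⇒≐ A≡B , ≡⇒≐ X̂₁≡Y , ≡⇒≐ X̂ₙ≡Z) ,
  trans S≡ (trans (cong₂ _+_ |BYZ|≡4m |BYZ|≡4m) (sym (*-distribʳ-+ m 4 4)))
  where open Path₃Construction B Y Z B#Y B#Z
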